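{- Let $\mathbb{k}$ be a field of characteristic zero, $A$ a commutative unital $\mathbb{k}$-algebra, $B$ a commutative unital $\mathbb{k}$-algebra which is an integral domain, and $f : A \to B$ a $\mathbb{k}$-linear map. If $a \in A$ satisfies $a^2 = a$ and $\Phi_{n+1}(f)(a,a,\dots,a) = 0$, then $f(a) = k\cdot 1_B$ for some integer $k$ with $0 \le k \le n$.
   Context: For a $\mathbb{k}$-linear map $f : A \to B$ and $m \ge 1$, define $\Phi_m(f)(a_1,\dots,a_m) = \sum_{\sigma \in \Sigma_m} \epsilon(\sigma) f_\sigma(a_1,\dots,a_m)$, where $\epsilon(\sigma)$ is the sign, and if $\sigma = \gamma_1\cdots\gamma_q$ is the disjoint cycle decomposition (including cycles of length one) then $f_\sigma = \prod_j f_{\gamma_j}$ with $f_\gamma(a_1,\dots,a_m) = f(a_{r_1}\cdots a_{r_j})$ for $\gamma = (r_1\,\dots\,r_j)$. -}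

module Defs where

open import Level using (Level; _⊔_)
open import Data.Bool using (Bool; true; false; if_then_else_; _∧_; not)
open import Data.Nat as ℕ using (ℕ; zero; suc)
open import Data.Fin using (Fin; toℕ)
open import Data.Fin.Properties using () renaming (_≟_ to _≟ᶠ_)
open import Data.Bool.ListAction using (all; any)
open import Data.Vec using (Vec; []; _∷_; lookup)
open import Data.List using (List; []; _∷_; [_]; map; concatMap; allFin; filterᵇ; upTo; length; foldr)
open import Relation.Nullary using (¬_; does)
open import Data.Product using (Σ; ∃; _×_; _,_)
open import Data.Sum using (_⊎_)
open import Relation.Binary.PropositionalEquality using (_≡_)
open import Algebra.Bundles using (CommutativeRing)
open import Algebra.Morphism.Structures using (module RingMorphisms)
import Algebra.Definitions.RawMonoid as RawMonoidDefs

module _ {c ℓ : Level} (R : CommutativeRing c ℓ) where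
  open CommutativeRing R

  natCast : ℕ → Carrier
  natCast n = RawMonoidDefs._×_ +-rawMonoid n 1#

  record IsField : Set (c ⊔ ℓ) where
    field
      1≉0     : ¬ (1# ≈ 0#)
      inverse : ∀ x → ¬ (x ≈ 0#) → ∃ λ y → x * y ≈ 1#

  CharZero : Set ℓ
  CharZero = ∀ n → natCast n ≈ 0# → n ≡ 0

  record IsIntegralDomain : Set (c ⊔ ℓ) where
    field
      1≉0          : ¬ (1# ≈ 0#)
      noZeroDivisors : ∀ x y → x * y ≈ 0# → (x ≈ 0#) ⊎ (y ≈ 0#)

record CAlgebra {k kℓ : Level} (K : CommutativeRing k kℓ) (c ℓ : Level)
       : Set (Level.suc (c ⊔ ℓ) ⊔ k ⊔ kℓ) where
  field
    commRing : CommutativeRing c ℓ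
  open CommutativeRing commRing public
  open RingMorphisms (CommutativeRing.rawRing K) (CommutativeRing.rawRing commRing)
  field
    ι     : CommutativeRing.Carrier K → Carrier
    ι-hom : IsRingHomomorphism ι

record IsLinear {k kℓ c₁ ℓ₁ c₂ ℓ₂ : Level} {K : CommutativeRing k kℓ}
       (A : CAlgebra K c₁ ℓ₁) (B : CAlgebra K c₂ ℓ₂)
       (f : CAlgebra.Carrier A → CAlgebra.Carrier B) : Set (k ⊔ c₁ ⊔ ℓ₁ ⊔ ℓ₂) where
  private
    module A = CAlgebra A
    module B = CAlgebra B
  field
    cong  : ∀ {x y} → x A.≈ y → f x B.≈ f y
    additive : ∀ x y → f (x A.+ y) B.≈ f x B.+ f y
    homogeneous : ∀ (λ' : CommutativeRing.Carrier K) x → f (A.ι λ' A.* x) B.≈ B.ι λ' B.* f x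

-- The symmetric group Σ_m, enumerated as the list of injective maps
-- Fin m → Fin m (stored as vectors of images).

_==_ : ∀ {m} → Fin m → Fin m → Bool
i == j = does (i ≟ᶠ j)

allVecs : (k n : ℕ) → List (Vec (Fin k) n)
allVecs k zero    = [ [] ]
allVecs k (suc n) = concatMap (λ i → map (i ∷_) (allVecs k n)) (allFin k)

isInjective : ∀ {m} → Vec (Fin m) m → Bool
isInjective {m} v =
  all (λ i → all (λ j → not (lookup v i == lookup v j) Data.Bool.∨ (i == j)) (allFin m)) (allFin m)
  where import Data.Bool

Perms : (m : ℕ) → List (Vec (Fin m) m)
Perms m = filterᵇ isInjective (allVecs m m)

iter : ∀ {m} → Vec (Fin m) m → ℕ → Fin m → Fin m
iter σ zero    i = i
iter σ (suc k) i = lookup σ (iter σ k i)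

inversions : ∀ {m} → Vec (Fin m) m → ℕ
inversions {m} σ = length (concatMap (λ i →
  filterᵇ (λ j → (toℕ i ℕ.<ᵇ toℕ j) ∧ (toℕ (lookup σ j) ℕ.<ᵇ toℕ (lookup σ i))) (allFin m)) (allFin m))

isEven : ℕ → Bool
isEven zero = true
isEven (suc n) = not (isEven n)

inCycle : ∀ {m} → Vec (Fin m) m → Fin m → Fin m → Bool
inCycle {m} σ i j = any (λ k → iter σ k i == j) (upTo m)

isCycleRep : ∀ {m} → Vec (Fin m) m → Fin m → Bool
isCycleRep {m} σ i = all (λ k → toℕ i ℕ.≤ᵇ toℕ (iter σ k i)) (upTo m)

-- Φ_m(f)(a₁,…,a_m) = Σ_σ ε(σ) Π_{cycles γ of σ} f(Π_{r ∈ γ} a_r)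

module _ {c₁ ℓ₁ c₂ ℓ₂ : Level} (A : CommutativeRing c₁ ℓ₁) (B : CommutativeRing c₂ ℓ₂) where
  private
    module A = CommutativeRing A
    module B = CommutativeRing B

  sign : ∀ {m} → Vec (Fin m) m → B.Carrier
  sign σ = if isEven (inversions σ) then B.1# else B.- B.1#

  fCycle : ∀ {m} → (A.Carrier → B.Carrier) → Vec (Fin m) m → (Fin m → A.Carrier) → Fin m → B.Carrier
  fCycle {m} f σ a i = f (foldr (λ j acc → a j A.* acc) A.1# (filterᵇ (inCycle σ i) (allFin m)))

  fPerm : ∀ {m} → (A.Carrier → B.Carrier) → Vec (Fin m) m → (Fin m → A.Carrier) → B.Carrier
  fPerm {m} f σ a = foldr (λ i acc → fCycle f σ a i B.* acc) B.1# (filterᵇ (isCycleRep σ) (allFin m))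

  Φ : (m : ℕ) → (A.Carrier → B.Carrier) → (Fin m → A.Carrier) → B.Carrier
  Φ m f a = foldr (λ σ acc → (sign σ B.* fPerm f σ a) B.+ acc) B.0# (Perms m)

-- With a idempotent, every cycle of a permutation σ contributes f(a), so
-- Φ_m(f)(a, …, a) = Σ_σ sgn(σ) x^c(σ), where x = f(a) and c(σ) is the number of cycles.
-- A permutation of {0, …, m} arises uniquely from one of {0, …, m - 1} either by adding m
-- as a fixed point (same sign, one more cycle) or by inserting m into a cycle right after
-- some p (opposite sign, same cycles). Hence the sum S_m satisfies S_(m+1) = (x - m) S_m,
-- so Φ_(n+1)(f)(a, …, a) = x (x - 1) ⋯ (x - n), and in an integral domain this vanishes
-- only if x = k for some k ≤ n.
{-# OPTIONS --safe #-}
module Submission where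

open import Defs
open import Level using (Level)
open import Function.Base using (_∘_; id)
open import Function.Bundles using (Equivalence; mk⇔)
open import Function.Definitions using (Injective)
open import Relation.Binary.PropositionalEquality using (_≡_; _≢_; _≗_)
import Relation.Binary.PropositionalEquality as P
open import Relation.Binary.Definitions using (tri<; tri≈; tri>)
import Relation.Binary.Reasoning.Setoid as ≈-Reasoning
open import Relation.Nullary using (yes; no)
open import Relation.Nullary.Decidable using (dec-true; dec-false; T?)
open import Relation.Nullary.Negation using (contradiction)
open import Data.Empty using (⊥; ⊥-elim)
open import Data.Product using (∃; ∃₂; _×_; _,_; proj₂)
open import Data.Sum using (_⊎_; inj₁; inj₂)
open import Data.Bool using (Bool; true; false; T; _∧_; _∨_; not; if_then_else_)
open import Data.Bool.Properties using (T-∨)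
open import Data.Maybe using (Maybe; nothing; just)
import Data.Maybe.Properties as Maybeₚ
open import Data.Nat using (ℕ; zero; suc; _∸_; _≤_; _<_; _<ᵇ_; _≤ᵇ_; z≤n; s≤s)
import Data.Nat.Properties as ℕ
open import Data.Nat.Induction using (<-rec)
open import Data.Nat.Tactic.RingSolver using (solve-∀)
open import Data.Fin as Fin using (Fin; toℕ; inject₁; fromℕ)
import Data.Fin.Properties as Finₚ
open import Data.Vec as Vec using (Vec; []; _∷_; _∷ʳ_; _[_]≔_; lookup)
import Data.Vec.Properties as Vecₚ
open import Data.Vec.Functional using (init; last)
open import Data.List as List using (List; []; _∷_; length; filterᵇ; concatMap; tabulate; upTo; allFin)
import Data.List.Properties as Listₚ
open import Data.List.Membership.Propositional using (_∈_)
open import Data.List.Membership.Propositional.Properties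
  using (∈-map⁺; ∈-allFin; ∈-filter⁺; ∈-filter⁻; ∈-cartesianProductWith⁺; ∈-cartesianProductWith⁻)
open import Data.List.Membership.Propositional.Properties.WithK using (unique∧set⇒bag)
open import Data.List.Relation.Unary.Any using (here; there)
import Data.List.Relation.Unary.All as All
open import Data.List.Relation.Unary.All.Properties as Allₚ
  using (all⁺; all⁻; applyUpTo⁺₁; applyUpTo⁻; tabulate⁺; tabulate⁻)
open import Data.List.Relation.Unary.AllPairs using (_∷_; [])
open import Data.List.Relation.Unary.Unique.Propositional using (Unique)
import Data.List.Relation.Unary.Unique.Propositional.Properties as Uniqueₚ
open import Data.List.Relation.Binary.BagAndSetEquality using (∼bag⇒↭)
open import Data.List.Relation.Binary.Permutation.Propositional using (_↭_; ↭⇒↭ₛ′)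
open import Data.List.Relation.Binary.Permutation.Propositional.Properties using () renaming (map⁺ to ↭-map⁺)
import Data.List.Relation.Binary.Permutation.Setoid.Properties as PermutationSetoidProperties
open import Algebra.Bundles using (CommutativeRing; Semiring)
import Algebra.Definitions.RawSemiring as RawSemiringDefinitions
import Algebra.Properties.CommutativeSemigroup as CommSemigroupProperties
import Algebra.Properties.Ring as RingProperties
open import Algebra.Properties.Semiring.Sum ℕ.+-*-semiring
  using (sum; sum-cong-≗; ∑-distrib-+; ∑-comm; *-distribˡ-sum; *-distribʳ-sum; sum-replicate-zero; sum-init-last)

-- ℕ's _+_ and _*_ and the ≡-combinators (refl, sym, trans, …) are opened only inside this
-- module, so that the ring operations and setoid laws of the same names can be used
-- unqualified after it.
module Combinatorics where
  open import Data.Nat using (_+_; _*_)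
  open import Relation.Binary.PropositionalEquality
    using (refl; sym; trans; cong; cong₂; subst; subst₂; module ≡-Reasoning)

  𝟙 : Bool → ℕ
  𝟙 true  = 1
  𝟙 false = 0

  T⇒𝟙≡1 : ∀ {b} → T b → 𝟙 b ≡ 1
  T⇒𝟙≡1 {true} _ = refl

  ¬T⇒𝟙≡0 : ∀ {b} → (T b → ⊥) → 𝟙 b ≡ 0
  ¬T⇒𝟙≡0 {true}  ¬b = ⊥-elim (¬b _)
  ¬T⇒𝟙≡0 {false} _  = refl

  count : ∀ {m} → (Fin m → Bool) → ℕ
  count P = sum (λ i → 𝟙 (P i))

  sum-ones : ∀ m → sum {m} (λ _ → 1) ≡ m
  sum-ones zero    = refl
  sum-ones (suc m) = cong suc (sum-ones m)

  ==-refl : ∀ {m} (i : Fin m) → (i == i) ≡ true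
  ==-refl i = dec-true (i Finₚ.≟ i) refl

  ==-≢ : ∀ {m} {i j : Fin m} → i ≢ j → (i == j) ≡ false
  ==-≢ {i = i} {j} = dec-false (i Finₚ.≟ j)

  ==⇒≡ : ∀ {m} {i j : Fin m} → T (i == j) → i ≡ j
  ==⇒≡ {i = i} {j} p with i Finₚ.≟ j
  ... | yes i≡j = i≡j

  sum-point : ∀ {m} (c : Fin m) (h : Fin m → ℕ) → sum (λ y → 𝟙 (c == y) * h y) ≡ h c
  sum-point {suc m} Fin.zero h = begin
    h Fin.zero + 0 + sum {m} (λ _ → 0) ≡⟨ cong (h Fin.zero + 0 +_) (sum-replicate-zero m) ⟩
    h Fin.zero + 0 + 0                 ≡⟨ cong (_+ 0) (ℕ.+-identityʳ _) ⟩
    h Fin.zero + 0                     ≡⟨ ℕ.+-identityʳ _ ⟩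
    h Fin.zero                         ∎
    where open ≡-Reasoning
  sum-point {suc m} (Fin.suc c) h = sum-point c (h ∘ Fin.suc)

  count-point : ∀ {m} (c : Fin m) → count (c ==_) ≡ 1
  count-point {m} c = trans (sum-cong-≗ {m} λ y → sym (ℕ.*-identityʳ (𝟙 (c == y)))) (sum-point c (λ _ → 1))

  sum₂ : ∀ {m} → (Fin m → Fin m → ℕ) → ℕ
  sum₂ {m} t = sum {m} λ i → sum {m} λ j → t i j

  sum₂-cong : ∀ {m} {t u : Fin m → Fin m → ℕ} → (∀ i j → t i j ≡ u i j) → sum₂ t ≡ sum₂ u
  sum₂-cong t≡u = sum-cong-≗ λ i → sum-cong-≗ (t≡u i)

  sum₂-distrib-+ : ∀ {m} (t u : Fin m → Fin m → ℕ) → sum₂ (λ i j → t i j + u i j) ≡ sum₂ t + sum₂ u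
  sum₂-distrib-+ t u =
    trans (sum-cong-≗ λ i → ∑-distrib-+ (t i) (u i)) (∑-distrib-+ (λ i → sum (t i)) (λ i → sum (u i)))

  sum₂-pointˡ : ∀ {m} (c : Fin m) (t : Fin m → ℕ) → sum₂ (λ i j → 𝟙 (c == i) * t j) ≡ sum t
  sum₂-pointˡ c t = trans (sum-cong-≗ λ i → sym (*-distribˡ-sum (𝟙 (c == i)) t)) (sum-point c (λ _ → sum t))

  sum₂-pointʳ : ∀ {m} (c : Fin m) (t : Fin m → ℕ) → sum₂ (λ i j → 𝟙 (c == j) * t i) ≡ sum t
  sum₂-pointʳ c t = sum-cong-≗ λ i → sum-point c (λ _ → t i)

  count-unique : ∀ {m} (P : Fin m → Bool) → (∀ {i j} → T (P i) → T (P j) → i ≡ j) → count P ≤ 1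
  count-unique {zero}  P unique = z≤n
  count-unique {suc m} P unique with P Fin.zero in P0
  ... | false = count-unique (P ∘ Fin.suc) (λ Pi Pj → Finₚ.suc-injective (unique Pi Pj))
  ... | true  = s≤s (ℕ.≤-reflexive (trans (sum-cong-≗ rest) (sum-replicate-zero m)))
    where
    rest : ∀ i → 𝟙 (P (Fin.suc i)) ≡ 0
    rest i with P (Fin.suc i) in Pi
    ... | false = refl
    ... | true with () ← unique (subst T (sym P0) _) (subst T (sym Pi) _)

  count>0⇒∃ : ∀ {m} (P : Fin m → Bool) → 0 < count P → ∃ λ i → T (P i)
  count>0⇒∃ {suc m} P pos with P Fin.zero in P0
  ... | true  = Fin.zero , subst T (sym P0) _
  ... | false with i , Pi ← count>0⇒∃ (P ∘ Fin.suc) pos = Fin.suc i , Pi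

  ≤1∧sum≡n⇒≡1 : ∀ {m} (t : Fin m → ℕ) → (∀ i → t i ≤ 1) → sum t ≡ m → ∀ i → t i ≡ 1
  ≤1∧sum≡n⇒≡1 {suc m} t t≤1 total i with t Fin.zero in t0 | t≤1 Fin.zero
  ... | 0 | _ = contradiction total (ℕ.<⇒≢ (s≤s (sum≤ (t ∘ Fin.suc) (t≤1 ∘ Fin.suc))))
    where
    sum≤ : ∀ {n} (u : Fin n → ℕ) → (∀ i → u i ≤ 1) → sum u ≤ n
    sum≤ {zero}  u u≤1 = z≤n
    sum≤ {suc n} u u≤1 = ℕ.+-mono-≤ (u≤1 Fin.zero) (sum≤ (u ∘ Fin.suc) (u≤1 ∘ Fin.suc))
  ... | suc (suc _) | s≤s ()
  ... | 1 | _ with i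
  ...   | Fin.zero  = t0
  ...   | Fin.suc i = ≤1∧sum≡n⇒≡1 (t ∘ Fin.suc) (t≤1 ∘ Fin.suc) (ℕ.suc-injective total) i

  module _ {m} {g : Fin m → Fin m} (g-injective : Injective _≡_ _≡_ g) where

    count-fibre : ∀ y → count (λ i → g i == y) ≡ 1
    count-fibre = ≤1∧sum≡n⇒≡1 fibre fibre≤1 total
      where
      fibre : Fin m → ℕ
      fibre y = count (λ i → g i == y)
      fibre≤1 : ∀ y → fibre y ≤ 1
      fibre≤1 y = count-unique (λ i → g i == y) (λ p q → g-injective (trans (==⇒≡ p) (sym (==⇒≡ q))))
      total : sum fibre ≡ m
      total = begin
        sum fibre                                      ≡⟨ ∑-comm (λ i y → 𝟙 (g i == y)) ⟨
        sum (λ i → count (g i ==_))                    ≡⟨ sum-cong-≗ (count-point ∘ g) ⟩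
        sum {m} (λ _ → 1)                              ≡⟨ sum-ones m ⟩
        m                                              ∎
        where open ≡-Reasoning

    sum-reindex : ∀ h → sum (λ i → h (g i)) ≡ sum h
    sum-reindex h = begin
      sum (λ i → h (g i))                           ≡⟨ sum-cong-≗ (λ i → sum-point (g i) h) ⟨
      sum (λ i → sum (λ y → 𝟙 (g i == y) * h y))    ≡⟨ ∑-comm (λ i y → 𝟙 (g i == y) * h y) ⟩
      sum (λ y → sum (λ i → 𝟙 (g i == y) * h y))    ≡⟨ sum-cong-≗ (λ y → *-distribʳ-sum (h y) (𝟙 ∘ (_== y) ∘ g)) ⟨
      sum (λ y → count (λ i → g i == y) * h y)      ≡⟨ sum-cong-≗ (λ y → cong (_* h y) (count-fibre y)) ⟩
      sum (λ y → 1 * h y)                           ≡⟨ sum-cong-≗ (λ y → ℕ.*-identityˡ (h y)) ⟩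
      sum h                                         ∎
      where open ≡-Reasoning

  [_<_] : ℕ → ℕ → ℕ
  [ a < b ] = 𝟙 (a <ᵇ b)

  <⇒[<]≡1 : ∀ {a b} → a < b → [ a < b ] ≡ 1
  <⇒[<]≡1 {a} {b} a<b with a <ᵇ b | ℕ.<⇒<ᵇ a<b
  ... | true | _ = refl

  ≥⇒[<]≡0 : ∀ {a b} → b ≤ a → [ a < b ] ≡ 0
  ≥⇒[<]≡0 {a} {b} b≤a with a <ᵇ b in eq
  ... | false = refl
  ... | true  = contradiction (ℕ.<ᵇ⇒< a b (subst T (sym eq) _)) (ℕ.≤⇒≯ b≤a)

  [<]-irrefl : ∀ a → [ a < a ] ≡ 0
  [<]-irrefl a = ≥⇒[<]≡0 {a} ℕ.≤-refl

  [<]-trichotomy : ∀ {a b} → a ≢ b → [ a < b ] + [ b < a ] ≡ 1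
  [<]-trichotomy {a} {b} a≢b with ℕ.<-cmp a b
  ... | tri< a<b _ _ rewrite <⇒[<]≡1 a<b | ≥⇒[<]≡0 (ℕ.<⇒≤ a<b) = refl
  ... | tri≈ _ a≡b _ = contradiction a≡b a≢b
  ... | tri> _ _ b<a rewrite <⇒[<]≡1 b<a | ≥⇒[<]≡0 (ℕ.<⇒≤ b<a) = refl

  count-below : ∀ {m} t → t ≤ m → count {m} (λ i → toℕ i <ᵇ t) ≡ t
  count-below {zero}  zero    z≤n       = refl
  count-below {suc m} zero    _         = sum-replicate-zero m
  count-below {suc m} (suc t) (s≤s t≤m) = cong suc (count-below t t≤m)

  count-above : ∀ {m} t → t < m → count {m} (λ i → t <ᵇ toℕ i) + suc t ≡ m
  count-above {suc m} zero    _         = trans (ℕ.+-comm (sum {m} (λ _ → 1)) 1) (cong suc (sum-ones m))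
  count-above {suc m} (suc t) (s≤s t<m) = trans (ℕ.+-suc _ (suc t)) (cong suc (count-above t t<m))

  length-filterᵇ-tabulate : ∀ {a} {A : Set a} {m} (P : A → Bool) (f : Fin m → A) →
    length (filterᵇ P (tabulate f)) ≡ count (P ∘ f)
  length-filterᵇ-tabulate {m = zero}  P f = refl
  length-filterᵇ-tabulate {m = suc m} P f with P (f Fin.zero)
  ... | true  = cong suc (length-filterᵇ-tabulate P (f ∘ Fin.suc))
  ... | false = length-filterᵇ-tabulate P (f ∘ Fin.suc)

  length-concatMap-tabulate : ∀ {a b} {A : Set a} {B : Set b} {m} (h : A → List B) (f : Fin m → A) →
    length (concatMap h (tabulate f)) ≡ sum (length ∘ h ∘ f)
  length-concatMap-tabulate {m = zero}  h f = refl
  length-concatMap-tabulate {m = suc m} h f =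
    trans (Listₚ.length-++ (h (f Fin.zero)))
          (cong (length (h (f Fin.zero)) +_) (length-concatMap-tabulate h (f ∘ Fin.suc)))

  𝟙-∧ : ∀ a b → 𝟙 (a ∧ b) ≡ 𝟙 a * 𝟙 b
  𝟙-∧ true  b = sym (ℕ.+-identityʳ (𝟙 b))
  𝟙-∧ false b = refl

  -- Inversions

  inverted : ∀ {m} → (Fin m → ℕ) → Fin m → Fin m → ℕ
  inverted w i j = [ toℕ i < toℕ j ] * [ w j < w i ]

  inversionCount : ∀ {m} → (Fin m → ℕ) → ℕ
  inversionCount w = sum₂ (inverted w)

  inversions≡inversionCount : ∀ {m} (σ : Vec (Fin m) m) → inversions σ ≡ inversionCount (toℕ ∘ lookup σ)
  inversions≡inversionCount {m} σ = trans (length-concatMap-tabulate {m = m} _ id) (sum-cong-≗ λ i →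
    trans (length-filterᵇ-tabulate (λ j → (toℕ i <ᵇ toℕ j) ∧ (toℕ (lookup σ j) <ᵇ toℕ (lookup σ i))) id)
          (sum-cong-≗ λ j → 𝟙-∧ (toℕ i <ᵇ toℕ j) (toℕ (lookup σ j) <ᵇ toℕ (lookup σ i))))

  inversionCount-cong : ∀ {m} {w w′ : Fin m → ℕ} → w ≗ w′ → inversionCount w ≡ inversionCount w′
  inversionCount-cong w≗w′ = sum-cong-≗ λ i → sum-cong-≗ λ j →
    cong₂ (λ a b → [ toℕ i < toℕ j ] * [ a < b ]) (w≗w′ j) (w≗w′ i)

  inject₁<fromℕ : ∀ {m} (i : Fin m) → toℕ (inject₁ i) < toℕ (fromℕ m)
  inject₁<fromℕ {m} i = subst (toℕ (inject₁ i) <_) (sym (Finₚ.toℕ-fromℕ m)) (Finₚ.inject₁ℕ< i)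

  inversionCount-init-last : ∀ {m} (w : Fin (suc m) → ℕ) →
    inversionCount w ≡ inversionCount (init w) + count (λ i → last w <ᵇ init w i)
  inversionCount-init-last {m} w = begin
    sum row
      ≡⟨ sum-init-last row ⟩
    sum (init row) + row (fromℕ m)
      ≡⟨ cong₂ _+_ (sum-cong-≗ row-inject₁) row-last ⟩
    sum (λ i → sum (inverted (init w) i) + [ last w < init w i ]) + 0
      ≡⟨ ℕ.+-identityʳ _ ⟩
    sum (λ i → sum (inverted (init w) i) + [ last w < init w i ])
      ≡⟨ ∑-distrib-+ (sum ∘ inverted (init w)) (λ i → [ last w < init w i ]) ⟩
    inversionCount (init w) + count (λ i → last w <ᵇ init w i) ∎
    where
    open ≡-Reasoning
    row : Fin (suc m) → ℕ
    row = sum ∘ inverted w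
    row-inject₁ : ∀ i → row (inject₁ i) ≡ sum (inverted (init w) i) + [ last w < init w i ]
    row-inject₁ i = trans (sum-init-last (inverted w (inject₁ i))) (cong₂ _+_
      (sum-cong-≗ λ j →
        cong₂ (λ a b → [ a < b ] * [ init w j < init w i ]) (Finₚ.toℕ-inject₁ i) (Finₚ.toℕ-inject₁ j))
      (trans (cong (_* [ last w < init w i ]) (<⇒[<]≡1 (inject₁<fromℕ i))) (ℕ.+-identityʳ _)))
    row-last : row (fromℕ m) ≡ 0
    row-last = trans (sum-cong-≗ λ j → cong (_* [ w j < last w ]) (≥⇒[<]≡0 (Finₚ.≤fromℕ j)))
                     (sum-replicate-zero (suc m))

  inversionCount-snoc-max : ∀ {m} (w : Fin (suc m) → ℕ) → (∀ i → init w i ≤ last w) →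
    inversionCount w ≡ inversionCount (init w)
  inversionCount-snoc-max {m} w below = trans (inversionCount-init-last w)
    (trans (cong (inversionCount (init w) +_) (trans (sum-cong-≗ (≥⇒[<]≡0 ∘ below)) (sum-replicate-zero m)))
           (ℕ.+-identityʳ _))

  isEven-double : ∀ k → isEven (k + k) ≡ true
  isEven-double zero    = refl
  isEven-double (suc k) rewrite ℕ.+-suc k k | isEven-double k = refl

  isEven-+-double : ∀ a k → isEven (a + (k + k)) ≡ isEven a
  isEven-+-double zero    k = isEven-double k
  isEven-+-double (suc a) k = cong not (isEven-+-double a k)

  isEven-odd-shift : ∀ {a b} k l → a + (k + k) ≡ suc (b + (l + l)) → isEven a ≡ not (isEven b)
  isEven-odd-shift {a} {b} k l eq = begin
    isEven a                       ≡⟨ isEven-+-double a k ⟨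
    isEven (a + (k + k))           ≡⟨ cong isEven eq ⟩
    not (isEven (b + (l + l)))     ≡⟨ cong not (isEven-+-double b l) ⟩
    not (isEven b)                 ∎
    where open ≡-Reasoning

  -- w lists the values of the permutation g with m inserted right after p. Only pairs
  -- through position p or the last position change status, and counting them shows that
  -- the number of inversions changes by an odd amount.
  module InsertionInversions
    {m} {g : Fin m → Fin m} (g-injective : Injective _≡_ _≡_ g) (p : Fin m)
    (w : Fin (suc m) → ℕ)
    (w-at-p : init w p ≡ m) (w-off-p : ∀ i → i ≢ p → init w i ≡ toℕ (g i)) (w-last : last w ≡ toℕ (g p))
    where

    v : Fin m → ℕ
    v = toℕ ∘ g

    q : ℕ
    q = v p

    w′ : Fin m → ℕ
    w′ = init w

    δ : Fin m → Fin m → ℕ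
    δ i j = 𝟙 (i == j)

    v<m : ∀ i → v i < m
    v<m i = Finₚ.toℕ<n (g i)

    #before-above #after-below #before-below #after #above : ℕ
    #before-above = sum {m} λ i → [ toℕ i < toℕ p ] * [ q < v i ]
    #after-below = sum {m} λ j → [ toℕ p < toℕ j ] * [ v j < q ]
    #before-below = sum {m} λ i → [ toℕ i < toℕ p ] * [ v i < q ]
    #after = sum {m} λ j → [ toℕ p < toℕ j ]
    #above = sum {m} λ i → [ q < v i ]

    column-p-before-above row-p-after-below : Fin m → Fin m → ℕ
    row-p-after-below i j = δ p i * ([ toℕ p < toℕ j ] * [ v j < q ])
    column-p-before-above i j = δ p j * ([ toℕ i < toℕ p ] * [ q < v i ])

    pair-correction : ∀ i j → inverted w′ i j + row-p-after-below i j + column-p-before-above i j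
                            ≡ inverted v i j + δ p i * [ toℕ p < toℕ j ]
    pair-correction i j with i Finₚ.≟ p | j Finₚ.≟ p
    ... | yes refl | yes refl rewrite ==-refl i | [<]-irrefl (toℕ i) = refl
    ... | yes refl | no j≢p rewrite ==-refl i | ==-≢ (j≢p ∘ sym) | w-at-p | w-off-p j j≢p | <⇒[<]≡1 (v<m j) =
      arith [ toℕ i < toℕ j ] [ v j < v i ]
      where
      arith : ∀ x y → x * 1 + (x * y + 0) + 0 ≡ x * y + (x + 0)
      arith = solve-∀
    ... | no i≢p | yes refl
      rewrite ==-refl j | ==-≢ (i≢p ∘ sym) | w-at-p | w-off-p i i≢p | ≥⇒[<]≡0 (ℕ.<⇒≤ (v<m i)) =
      arith [ toℕ i < toℕ j ] [ v j < v i ]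
      where
      arith : ∀ x y → x * 0 + 0 + (x * y + 0) ≡ x * y + 0
      arith = solve-∀
    ... | no i≢p | no j≢p rewrite ==-≢ (i≢p ∘ sym) | ==-≢ (j≢p ∘ sym) | w-off-p i i≢p | w-off-p j j≢p =
      ℕ.+-identityʳ _

    inversions-through-p : inversionCount w′ + #after-below + #before-above ≡ inversionCount v + #after
    inversions-through-p = begin
      inversionCount w′ + #after-below + #before-above
        ≡⟨ cong₂ (λ b a → inversionCount w′ + b + a)
                 (sum₂-pointˡ p (λ j → [ toℕ p < toℕ j ] * [ v j < q ]))
                 (sum₂-pointʳ p (λ i → [ toℕ i < toℕ p ] * [ q < v i ])) ⟨
      inversionCount w′ + sum₂ row-p-after-below + sum₂ column-p-before-above
        ≡⟨ cong (_+ sum₂ column-p-before-above) (sum₂-distrib-+ (inverted w′) row-p-after-below) ⟨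
      sum₂ (λ i j → inverted w′ i j + row-p-after-below i j) + sum₂ column-p-before-above
        ≡⟨ sum₂-distrib-+ (λ i j → inverted w′ i j + row-p-after-below i j) column-p-before-above ⟨
      sum₂ (λ i j → inverted w′ i j + row-p-after-below i j + column-p-before-above i j)
        ≡⟨ sum₂-cong pair-correction ⟩
      sum₂ (λ i j → inverted v i j + δ p i * [ toℕ p < toℕ j ])
        ≡⟨ sum₂-distrib-+ (inverted v) (λ i j → δ p i * [ toℕ p < toℕ j ]) ⟩
      inversionCount v + sum₂ (λ i j → δ p i * [ toℕ p < toℕ j ])
        ≡⟨ cong (inversionCount v +_) (sum₂-pointˡ p (λ j → [ toℕ p < toℕ j ])) ⟩
      inversionCount v + #after ∎
      where open ≡-Reasoning

    v-injective : ∀ {i} → i ≢ p → v i ≢ q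
    v-injective i≢p = i≢p ∘ g-injective ∘ Finₚ.toℕ-injective

    toℕ-≢ : ∀ {i} → i ≢ p → toℕ i ≢ toℕ p
    toℕ-≢ i≢p = i≢p ∘ Finₚ.toℕ-injective

    count-before-p : #before-above + #before-below ≡ toℕ p
    count-before-p =
      trans (sym (∑-distrib-+ (λ i → [ toℕ i < toℕ p ] * [ q < v i ]) (λ i → [ toℕ i < toℕ p ] * [ v i < q ])))
            (trans (sum-cong-≗ split) (count-below (toℕ p) (ℕ.<⇒≤ (Finₚ.toℕ<n p))))
      where
      split : ∀ i → [ toℕ i < toℕ p ] * [ q < v i ] + [ toℕ i < toℕ p ] * [ v i < q ] ≡ [ toℕ i < toℕ p ]
      split i with i Finₚ.≟ p
      ... | yes refl rewrite [<]-irrefl (toℕ i) = refl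
      ... | no i≢p = begin
        [ toℕ i < toℕ p ] * [ q < v i ] + [ toℕ i < toℕ p ] * [ v i < q ]
          ≡⟨ ℕ.*-distribˡ-+ [ toℕ i < toℕ p ] _ _ ⟨
        [ toℕ i < toℕ p ] * ([ q < v i ] + [ v i < q ])
          ≡⟨ cong ([ toℕ i < toℕ p ] *_) ([<]-trichotomy (v-injective i≢p ∘ sym)) ⟩
        [ toℕ i < toℕ p ] * 1
          ≡⟨ ℕ.*-identityʳ _ ⟩
        [ toℕ i < toℕ p ] ∎
        where open ≡-Reasoning

    count-below-q : #after-below + #before-below ≡ q
    count-below-q =
      trans (sym (∑-distrib-+ (λ j → [ toℕ p < toℕ j ] * [ v j < q ]) (λ j → [ toℕ j < toℕ p ] * [ v j < q ])))
            (trans (sum-cong-≗ split)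
                   (trans (sum-reindex g-injective (λ y → [ toℕ y < q ])) (count-below q (ℕ.<⇒≤ (v<m p)))))
      where
      split : ∀ j → [ toℕ p < toℕ j ] * [ v j < q ] + [ toℕ j < toℕ p ] * [ v j < q ] ≡ [ v j < q ]
      split j with j Finₚ.≟ p
      ... | yes refl rewrite [<]-irrefl q | [<]-irrefl (toℕ j) = refl
      ... | no j≢p = begin
        [ toℕ p < toℕ j ] * [ v j < q ] + [ toℕ j < toℕ p ] * [ v j < q ]
          ≡⟨ ℕ.*-distribʳ-+ [ v j < q ] [ toℕ p < toℕ j ] _ ⟨
        ([ toℕ p < toℕ j ] + [ toℕ j < toℕ p ]) * [ v j < q ]
          ≡⟨ cong (_* [ v j < q ]) ([<]-trichotomy (toℕ-≢ j≢p ∘ sym)) ⟩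
        1 * [ v j < q ]
          ≡⟨ ℕ.*-identityˡ _ ⟩
        [ v j < q ] ∎
        where open ≡-Reasoning

    count-after-p : #after + suc (toℕ p) ≡ m
    count-after-p = count-above (toℕ p) (Finₚ.toℕ<n p)

    count-above-q : #above + suc q ≡ m
    count-above-q = trans (cong (_+ suc q) (sum-reindex g-injective (λ y → [ q < toℕ y ]))) (count-above q (v<m p))

    count-last-row : count (λ i → last w <ᵇ w′ i) ≡ suc #above
    count-last-row =
      trans (sum-cong-≗ split) (trans (∑-distrib-+ (δ p) (λ i → [ q < v i ])) (cong (_+ #above) (count-point p)))
      where
      split : ∀ i → [ last w < w′ i ] ≡ δ p i + [ q < v i ]
      split i with i Finₚ.≟ p
      ... | yes refl rewrite ==-refl i | w-last | w-at-p | <⇒[<]≡1 (v<m i) | [<]-irrefl q = refl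
      ... | no i≢p rewrite ==-≢ (i≢p ∘ sym) | w-last | w-off-p i i≢p = refl

    parity-flips : isEven (inversionCount w) ≡ not (isEven (inversionCount v))
    parity-flips = isEven-odd-shift {inversionCount w} {inversionCount v} (toℕ p + q + 1) (m + #before-below) (begin
      inversionCount w + (toℕ p + q + 1 + (toℕ p + q + 1))
        ≡⟨ cong (_+ (toℕ p + q + 1 + (toℕ p + q + 1)))
                (trans (inversionCount-init-last w) (cong (inversionCount w′ +_) count-last-row)) ⟩
      inversionCount w′ + suc #above + (toℕ p + q + 1 + (toℕ p + q + 1))
        ≡⟨ arithmetic {inversionCount w′} {inversionCount v}
                      {#before-above} {#after-below} {#before-below} {#after} {#above}
             inversions-through-p count-before-p count-below-q count-after-p count-above-q ⟩
      suc (inversionCount v + (m + #before-below + (m + #before-below))) ∎)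
      where
      open ≡-Reasoning
      arithmetic : ∀ {X Y A B C D E p q m} →
                   X + B + A ≡ Y + D → A + C ≡ p → B + C ≡ q → D + suc p ≡ m → E + suc q ≡ m →
                   X + suc E + (p + q + 1 + (p + q + 1)) ≡ suc (Y + (m + C + (m + C)))
      arithmetic {X} {Y} {A} {B} {C} {D} {E} X+B+A≡Y+D refl refl refl E+q+1≡m = begin
        X + suc E + (A + C + (B + C) + 1 + (A + C + (B + C) + 1))
          ≡⟨ regroupˡ X A B C E ⟩
        (X + B + A) + (E + suc (B + C)) + (A + 3 * C + 2)
          ≡⟨ cong₂ (λ s t → s + t + (A + 3 * C + 2)) X+B+A≡Y+D E+q+1≡m ⟩
        (Y + D) + (D + suc (A + C)) + (A + 3 * C + 2)
          ≡⟨ regroupʳ Y A C D ⟩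
        suc (Y + (D + suc (A + C) + C + (D + suc (A + C) + C))) ∎
        where
        regroupˡ : ∀ X A B C E → X + suc E + (A + C + (B + C) + 1 + (A + C + (B + C) + 1))
                               ≡ (X + B + A) + (E + suc (B + C)) + (A + 3 * C + 2)
        regroupˡ = solve-∀
        regroupʳ : ∀ Y A C D → (Y + D) + (D + suc (A + C)) + (A + 3 * C + 2)
                             ≡ suc (Y + (D + suc (A + C) + C + (D + suc (A + C) + C)))
        regroupʳ = solve-∀

  -- Cycles

  T-ext : ∀ {a b} → (T a → T b) → (T b → T a) → a ≡ b
  T-ext {true}  {true}  _   _   = refl
  T-ext {true}  {false} a⇒b _   = ⊥-elim (a⇒b _)
  T-ext {false} {true}  _   b⇒a = ⊥-elim (b⇒a _)
  T-ext {false} {false} _   _   = refl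

  module _ {m} (σ : Vec (Fin m) m) where

    iter-+ : ∀ k l i → iter σ (k + l) i ≡ iter σ k (iter σ l i)
    iter-+ zero    l i = refl
    iter-+ (suc k) l i = cong (lookup σ) (iter-+ k l i)

    -- Two of the m + 1 iterates σ^(k - m) i, …, σ^k i coincide; cutting out the loop between
    -- them shortens the exponent.
    iter-shorten : ∀ {k} i → m ≤ k → ∃ λ k′ → k′ < k × iter σ k i ≡ iter σ k′ i
    iter-shorten {k} i m≤k = shorten (Finₚ.pigeonhole (ℕ.n<1+n m) h)
      where
      b : ℕ
      b = k ∸ m
      h : Fin (suc m) → Fin m
      h t = iter σ (toℕ t + b) i
      shorten : (∃₂ λ t₁ t₂ → t₁ Fin.< t₂ × h t₁ ≡ h t₂) →
                ∃ λ k′ → k′ < k × iter σ k i ≡ iter σ k′ i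
      shorten (t₁ , t₂ , t₁<t₂ , h-t₁≡h-t₂) =
        (m ∸ c) + (a + b) ,
        subst ((m ∸ c) + (a + b) <_) k≡ (ℕ.+-monoʳ-< (m ∸ c) (ℕ.+-monoˡ-< b t₁<t₂)) ,
        (begin
          iter σ k i                       ≡⟨ cong (λ n → iter σ n i) k≡ ⟨
          iter σ ((m ∸ c) + (c + b)) i     ≡⟨ iter-+ (m ∸ c) (c + b) i ⟩
          iter σ (m ∸ c) (h t₂)            ≡⟨ cong (iter σ (m ∸ c)) h-t₁≡h-t₂ ⟨
          iter σ (m ∸ c) (h t₁)            ≡⟨ iter-+ (m ∸ c) (a + b) i ⟨
          iter σ ((m ∸ c) + (a + b)) i     ∎)
        where
        open ≡-Reasoning
        a c : ℕ
        a = toℕ t₁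
        c = toℕ t₂
        k≡ : (m ∸ c) + (c + b) ≡ k
        k≡ = trans (sym (ℕ.+-assoc (m ∸ c) c b))
               (trans (cong (_+ b) (ℕ.m∸n+n≡m (ℕ.≤-pred (Finₚ.toℕ<n t₂)))) (ℕ.m+[n∸m]≡n m≤k))

    iter-bounded : ∀ k i → ∃ λ k′ → k′ < m × iter σ k i ≡ iter σ k′ i
    iter-bounded = <-rec _ step
      where
      step : ∀ k → (∀ {j} → j < k → ∀ i → ∃ λ k′ → k′ < m × iter σ j i ≡ iter σ k′ i) →
             ∀ i → ∃ λ k′ → k′ < m × iter σ k i ≡ iter σ k′ i
      step k rec i with k ℕ.<? m
      ... | yes k<m = k , k<m , refl
      ... | no  k≮m with j , j<k , eq ← iter-shorten i (ℕ.≮⇒≥ k≮m)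
                    with k′ , k′<m , eq′ ← rec j<k i = k′ , k′<m , trans eq eq′

    MinimalInCycle : Fin m → Set
    MinimalInCycle i = ∀ k → toℕ i ≤ toℕ (iter σ k i)

    isCycleRep⇒minimal : ∀ {i} → T (isCycleRep σ i) → MinimalInCycle i
    isCycleRep⇒minimal {i} rep k with k′ , k′<m , eq ← iter-bounded k i =
      subst (λ j → toℕ i ≤ toℕ j) (sym eq)
        (ℕ.≤ᵇ⇒≤ _ _ (applyUpTo⁻ id m (all⁺ (λ k → toℕ i ≤ᵇ toℕ (iter σ k i)) (upTo m) rep) k′<m))

    minimal⇒isCycleRep : ∀ {i} → MinimalInCycle i → T (isCycleRep σ i)
    minimal⇒isCycleRep {i} minimal =
      all⁻ (λ k → toℕ i ≤ᵇ toℕ (iter σ k i)) (applyUpTo⁺₁ id m (λ {k} _ → ℕ.≤⇒≤ᵇ (minimal k)))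

  cycleCount : ∀ {m} → Vec (Fin m) m → ℕ
  cycleCount σ = count (isCycleRep σ)

  toℕ-inject₁-≤ : ∀ {m} {i j : Fin m} → toℕ i ≤ toℕ j → toℕ (inject₁ i) ≤ toℕ (inject₁ j)
  toℕ-inject₁-≤ {i = i} {j} = subst₂ _≤_ (sym (Finₚ.toℕ-inject₁ i)) (sym (Finₚ.toℕ-inject₁ j))

  toℕ-inject₁-≤⁻ : ∀ {m} {i j : Fin m} → toℕ (inject₁ i) ≤ toℕ (inject₁ j) → toℕ i ≤ toℕ j
  toℕ-inject₁-≤⁻ {i = i} {j} = subst₂ _≤_ (Finₚ.toℕ-inject₁ i) (Finₚ.toℕ-inject₁ j)

  module FixedPointExtension {m} (σ : Vec (Fin m) m) (σ′ : Vec (Fin (suc m)) (suc m))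
    (σ′-inject₁ : ∀ i → lookup σ′ (inject₁ i) ≡ inject₁ (lookup σ i))
    (σ′-last : lookup σ′ (fromℕ m) ≡ fromℕ m)
    where

    iter-inject₁ : ∀ k i → iter σ′ k (inject₁ i) ≡ inject₁ (iter σ k i)
    iter-inject₁ zero    i = refl
    iter-inject₁ (suc k) i = trans (cong (lookup σ′) (iter-inject₁ k i)) (σ′-inject₁ _)

    iter-last : ∀ k → iter σ′ k (fromℕ m) ≡ fromℕ m
    iter-last zero    = refl
    iter-last (suc k) = trans (cong (lookup σ′) (iter-last k)) σ′-last

    isCycleRep-inject₁ : ∀ i → isCycleRep σ′ (inject₁ i) ≡ isCycleRep σ i
    isCycleRep-inject₁ i = T-ext
      (λ rep → minimal⇒isCycleRep σ λ k → toℕ-inject₁-≤⁻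
        (subst (λ j → toℕ (inject₁ i) ≤ toℕ j) (iter-inject₁ k i) (isCycleRep⇒minimal σ′ rep k)))
      (λ rep → minimal⇒isCycleRep σ′ λ k →
        subst (λ j → toℕ (inject₁ i) ≤ toℕ j) (sym (iter-inject₁ k i))
              (toℕ-inject₁-≤ (isCycleRep⇒minimal σ rep k)))

    isCycleRep-last : T (isCycleRep σ′ (fromℕ m))
    isCycleRep-last = minimal⇒isCycleRep σ′ λ k → ℕ.≤-reflexive (cong toℕ (sym (iter-last k)))

    cycleCount-extend : cycleCount σ′ ≡ suc (cycleCount σ)
    cycleCount-extend = begin
      cycleCount σ′
        ≡⟨ sum-init-last (𝟙 ∘ isCycleRep σ′) ⟩
      count (isCycleRep σ′ ∘ inject₁) + 𝟙 (isCycleRep σ′ (fromℕ m))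
        ≡⟨ cong₂ _+_ (sum-cong-≗ (cong 𝟙 ∘ isCycleRep-inject₁)) (T⇒𝟙≡1 isCycleRep-last) ⟩
      cycleCount σ + 1
        ≡⟨ ℕ.+-comm (cycleCount σ) 1 ⟩
      suc (cycleCount σ) ∎
      where open ≡-Reasoning

  module CycleInsertion {m} (σ : Vec (Fin m) m) (σ′ : Vec (Fin (suc m)) (suc m)) (p : Fin m)
    (σ′-inject₁ : ∀ i → i ≢ p → lookup σ′ (inject₁ i) ≡ inject₁ (lookup σ i))
    (σ′-p : lookup σ′ (inject₁ p) ≡ fromℕ m) (σ′-last : lookup σ′ (fromℕ m) ≡ inject₁ (lookup σ p))
    where

    iter-inject₁ : ∀ k i → ∃ λ k′ → iter σ′ k′ (inject₁ i) ≡ inject₁ (iter σ k i)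
    iter-inject₁ zero    i = 0 , refl
    iter-inject₁ (suc k) i with k′ , eq ← iter-inject₁ k i | iter σ k i Finₚ.≟ p
    ... | no  ≢p = suc k′ , trans (cong (lookup σ′) eq) (σ′-inject₁ _ ≢p)
    ... | yes ≡p = suc (suc k′) , (begin
      lookup σ′ (lookup σ′ (iter σ′ k′ (inject₁ i)))
        ≡⟨ cong (lookup σ′ ∘ lookup σ′) (trans eq (cong inject₁ ≡p)) ⟩
      lookup σ′ (lookup σ′ (inject₁ p))               ≡⟨ cong (lookup σ′) σ′-p ⟩
      lookup σ′ (fromℕ m)                             ≡⟨ σ′-last ⟩
      inject₁ (lookup σ p)                            ≡⟨ cong (inject₁ ∘ lookup σ) ≡p ⟨
      inject₁ (lookup σ (iter σ k i))                 ∎)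
      where open ≡-Reasoning

    iter-inject₁⁻ : ∀ k′ i → (∃ λ k → iter σ′ k′ (inject₁ i) ≡ inject₁ (iter σ k i))
                           ⊎ (iter σ′ k′ (inject₁ i) ≡ fromℕ m × ∃ λ k → iter σ k i ≡ p)
    iter-inject₁⁻ zero     i = inj₁ (0 , refl)
    iter-inject₁⁻ (suc k′) i with iter-inject₁⁻ k′ i
    ... | inj₂ (eq , k , ≡p) =
      inj₁ (suc k , trans (cong (lookup σ′) eq) (trans σ′-last (cong (inject₁ ∘ lookup σ) (sym ≡p))))
    ... | inj₁ (k , eq) with iter σ k i Finₚ.≟ p
    ...   | no  ≢p = inj₁ (suc k , trans (cong (lookup σ′) eq) (σ′-inject₁ _ ≢p))
    ...   | yes ≡p = inj₂ (trans (cong (lookup σ′) (trans eq (cong inject₁ ≡p))) σ′-p , k , ≡p)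

    isCycleRep-inject₁ : ∀ i → isCycleRep σ′ (inject₁ i) ≡ isCycleRep σ i
    isCycleRep-inject₁ i = T-ext
      (λ rep → minimal⇒isCycleRep σ λ k → let k′ , eq = iter-inject₁ k i in
        toℕ-inject₁-≤⁻ (subst (λ j → toℕ (inject₁ i) ≤ toℕ j) eq (isCycleRep⇒minimal σ′ rep k′)))
      (λ rep → minimal⇒isCycleRep σ′ λ k′ → lift (isCycleRep⇒minimal σ rep) (iter-inject₁⁻ k′ i))
      where
      lift : MinimalInCycle σ i → ∀ {j} →
             (∃ λ k → j ≡ inject₁ (iter σ k i)) ⊎ (j ≡ fromℕ m × ∃ λ k → iter σ k i ≡ p) →
             toℕ (inject₁ i) ≤ toℕ j
      lift minimal (inj₁ (k , refl))   = toℕ-inject₁-≤ (minimal k)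
      lift minimal (inj₂ (refl , _))   = Finₚ.≤fromℕ (inject₁ i)

    isCycleRep-last : T (isCycleRep σ′ (fromℕ m)) → ⊥
    isCycleRep-last rep = ℕ.<⇒≱ (Finₚ.toℕ<n (lookup σ p))
      (subst₂ _≤_ (Finₚ.toℕ-fromℕ m) (trans (cong toℕ σ′-last) (Finₚ.toℕ-inject₁ _))
                  (isCycleRep⇒minimal σ′ rep 1))

    cycleCount-insert : cycleCount σ′ ≡ cycleCount σ
    cycleCount-insert = begin
      cycleCount σ′
        ≡⟨ sum-init-last (𝟙 ∘ isCycleRep σ′) ⟩
      count (isCycleRep σ′ ∘ inject₁) + 𝟙 (isCycleRep σ′ (fromℕ m))
        ≡⟨ cong₂ _+_ (sum-cong-≗ (cong 𝟙 ∘ isCycleRep-inject₁)) (¬T⇒𝟙≡0 isCycleRep-last) ⟩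
      cycleCount σ + 0
        ≡⟨ ℕ.+-identityʳ (cycleCount σ) ⟩
      cycleCount σ ∎
      where open ≡-Reasoning

  -- Permutations of Fin (suc m) from permutations of Fin m

  data InitOrLast {m} : Fin (suc m) → Set where
    init′ : ∀ i → InitOrLast (inject₁ i)
    last′ : InitOrLast (fromℕ m)

  initOrLast : ∀ {m} (i : Fin (suc m)) → InitOrLast i
  initOrLast {zero}  Fin.zero    = last′
  initOrLast {suc m} Fin.zero    = init′ Fin.zero
  initOrLast {suc m} (Fin.suc i) with initOrLast i
  ... | init′ j = init′ (Fin.suc j)
  ... | last′   = last′

  inject₁≢fromℕ : ∀ {m} {i : Fin m} → inject₁ i ≢ fromℕ m
  inject₁≢fromℕ = Finₚ.fromℕ≢inject₁ ∘ sym

  lookup-∷ʳ-inject₁ : ∀ {a} {A : Set a} {n} (xs : Vec A n) y i → lookup (xs ∷ʳ y) (inject₁ i) ≡ lookup xs i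
  lookup-∷ʳ-inject₁ (x ∷ xs) y Fin.zero    = refl
  lookup-∷ʳ-inject₁ (x ∷ xs) y (Fin.suc i) = lookup-∷ʳ-inject₁ xs y i

  lookup-∷ʳ-last : ∀ {a} {A : Set a} {n} (xs : Vec A n) y → lookup (xs ∷ʳ y) (fromℕ n) ≡ y
  lookup-∷ʳ-last []       y = refl
  lookup-∷ʳ-last (x ∷ xs) y = lookup-∷ʳ-last xs y

  -- extend nothing σ adds the new point m as a fixed point; extend (just p) σ inserts m
  -- into the cycle of p, right after p.
  extend : ∀ {m} → Maybe (Fin m) → Vec (Fin m) m → Vec (Fin (suc m)) (suc m)
  extend {m} nothing  σ = Vec.map inject₁ σ ∷ʳ fromℕ m
  extend {m} (just p) σ = (Vec.map inject₁ σ [ p ]≔ fromℕ m) ∷ʳ inject₁ (lookup σ p)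

  module _ {m} (σ : Vec (Fin m) m) where

    extend-fixed-inject₁ : ∀ i → lookup (extend nothing σ) (inject₁ i) ≡ inject₁ (lookup σ i)
    extend-fixed-inject₁ i =
      trans (lookup-∷ʳ-inject₁ (Vec.map inject₁ σ) (fromℕ m) i) (Vecₚ.lookup-map i inject₁ σ)

    extend-fixed-last : lookup (extend nothing σ) (fromℕ m) ≡ fromℕ m
    extend-fixed-last = lookup-∷ʳ-last (Vec.map inject₁ σ) (fromℕ m)

    extend-after-inject₁ : ∀ p i → i ≢ p → lookup (extend (just p) σ) (inject₁ i) ≡ inject₁ (lookup σ i)
    extend-after-inject₁ p i i≢p =
      trans (lookup-∷ʳ-inject₁ (Vec.map inject₁ σ [ p ]≔ fromℕ m) (inject₁ (lookup σ p)) i)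
            (trans (Vecₚ.lookup∘update′ i≢p (Vec.map inject₁ σ) (fromℕ m)) (Vecₚ.lookup-map i inject₁ σ))

    extend-after-p : ∀ p → lookup (extend (just p) σ) (inject₁ p) ≡ fromℕ m
    extend-after-p p =
      trans (lookup-∷ʳ-inject₁ (Vec.map inject₁ σ [ p ]≔ fromℕ m) (inject₁ (lookup σ p)) p)
            (Vecₚ.lookup∘update p (Vec.map inject₁ σ) (fromℕ m))

    extend-after-last : ∀ p → lookup (extend (just p) σ) (fromℕ m) ≡ inject₁ (lookup σ p)
    extend-after-last p = lookup-∷ʳ-last (Vec.map inject₁ σ [ p ]≔ fromℕ m) (inject₁ (lookup σ p))

  IsPermutation : ∀ {m} → Vec (Fin m) m → Set
  IsPermutation σ = Injective _≡_ _≡_ (lookup σ)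

  extend-isPermutation : ∀ {m} j (σ : Vec (Fin m) m) → IsPermutation σ → IsPermutation (extend j σ)
  extend-isPermutation nothing σ σ-perm {a} {b} eq with initOrLast a | initOrLast b
  ... | init′ i | init′ k = cong inject₁ (σ-perm (Finₚ.inject₁-injective
                              (subst₂ _≡_ (extend-fixed-inject₁ σ i) (extend-fixed-inject₁ σ k) eq)))
  ... | init′ i | last′   =
    ⊥-elim (inject₁≢fromℕ (subst₂ _≡_ (extend-fixed-inject₁ σ i) (extend-fixed-last σ) eq))
  ... | last′   | init′ k =
    ⊥-elim (inject₁≢fromℕ (subst₂ _≡_ (extend-fixed-inject₁ σ k) (extend-fixed-last σ) (sym eq)))
  ... | last′   | last′   = refl
  extend-isPermutation (just p) σ σ-perm {a} {b} eq with initOrLast a | initOrLast b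
  ... | last′ | last′ = refl
  ... | init′ i | init′ k with i Finₚ.≟ p | k Finₚ.≟ p
  ...   | yes refl | yes refl = refl
  ...   | no i≢p   | no k≢p   = cong inject₁ (σ-perm (Finₚ.inject₁-injective
    (subst₂ _≡_ (extend-after-inject₁ σ p i i≢p) (extend-after-inject₁ σ p k k≢p) eq)))
  ...   | yes refl | no k≢p   =
    ⊥-elim (inject₁≢fromℕ (subst₂ _≡_ (extend-after-inject₁ σ i k k≢p) (extend-after-p σ i) (sym eq)))
  ...   | no i≢p   | yes refl =
    ⊥-elim (inject₁≢fromℕ (subst₂ _≡_ (extend-after-inject₁ σ k i i≢p) (extend-after-p σ k) eq))
  extend-isPermutation (just p) σ σ-perm {a} {b} eq | init′ i | last′ with i Finₚ.≟ p
  ... | yes refl = ⊥-elim (inject₁≢fromℕ (subst₂ _≡_ (extend-after-last σ i) (extend-after-p σ i) (sym eq)))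
  ... | no i≢p   = contradiction (σ-perm (Finₚ.inject₁-injective
                     (subst₂ _≡_ (extend-after-inject₁ σ p i i≢p) (extend-after-last σ p) eq))) i≢p
  extend-isPermutation (just p) σ σ-perm {a} {b} eq | last′ | init′ k with k Finₚ.≟ p
  ... | yes refl = ⊥-elim (inject₁≢fromℕ (subst₂ _≡_ (extend-after-last σ k) (extend-after-p σ k) eq))
  ... | no k≢p   = contradiction (σ-perm (Finₚ.inject₁-injective
                     (subst₂ _≡_ (extend-after-inject₁ σ p k k≢p) (extend-after-last σ p) (sym eq)))) k≢p

  extend-isPermutation⁻ : ∀ {m} j (σ : Vec (Fin m) m) → IsPermutation (extend j σ) → IsPermutation σ
  extend-isPermutation⁻ nothing σ perm {i} {k} eq = Finₚ.inject₁-injective (perm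
    (subst₂ _≡_ (sym (extend-fixed-inject₁ σ i)) (sym (extend-fixed-inject₁ σ k)) (cong inject₁ eq)))
  extend-isPermutation⁻ (just p) σ perm {i} {k} eq with i Finₚ.≟ p | k Finₚ.≟ p
  ... | yes refl | yes refl = refl
  ... | no i≢p   | no k≢p   = Finₚ.inject₁-injective (perm
    (subst₂ _≡_ (sym (extend-after-inject₁ σ p i i≢p)) (sym (extend-after-inject₁ σ p k k≢p)) (cong inject₁ eq)))
  ... | yes refl | no k≢p   = ⊥-elim (inject₁≢fromℕ (sym (perm
    (subst₂ _≡_ (sym (extend-after-last σ i)) (sym (extend-after-inject₁ σ i k k≢p)) (cong inject₁ eq)))))
  ... | no i≢p   | yes refl = ⊥-elim (inject₁≢fromℕ (perm
    (subst₂ _≡_ (sym (extend-after-inject₁ σ k i i≢p)) (sym (extend-after-last σ k)) (cong inject₁ eq))))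

  lookup-ext : ∀ {a} {A : Set a} {n} {xs ys : Vec A n} → lookup xs ≗ lookup ys → xs ≡ ys
  lookup-ext {xs = xs} {ys} eq =
    subst₂ _≡_ (Vecₚ.tabulate∘lookup xs) (Vecₚ.tabulate∘lookup ys) (Vecₚ.tabulate-cong eq)

  extend-injective : ∀ {m} {j j′ : Maybe (Fin m)} {σ σ′ : Vec (Fin m) m} →
                     extend j σ ≡ extend j′ σ′ → j ≡ j′ × σ ≡ σ′
  extend-injective {j = nothing} {nothing} {σ} {σ′} eq = refl , lookup-ext λ i → Finₚ.inject₁-injective
    (subst₂ _≡_ (extend-fixed-inject₁ σ i) (extend-fixed-inject₁ σ′ i) (cong (λ v → lookup v (inject₁ i)) eq))
  extend-injective {j = nothing} {just p′} {σ} {σ′} eq = ⊥-elim (inject₁≢fromℕ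
    (subst₂ _≡_ (extend-fixed-inject₁ σ p′) (extend-after-p σ′ p′) (cong (λ v → lookup v (inject₁ p′)) eq)))
  extend-injective {j = just p} {nothing} {σ} {σ′} eq = ⊥-elim (inject₁≢fromℕ
    (subst₂ _≡_ (extend-fixed-inject₁ σ′ p) (extend-after-p σ p) (cong (λ v → lookup v (inject₁ p)) (sym eq))))
  extend-injective {m} {just p} {just p′} {σ} {σ′} eq with p Finₚ.≟ p′
  ... | no p≢p′ = ⊥-elim (inject₁≢fromℕ
    (subst₂ _≡_ (extend-after-inject₁ σ′ p′ p p≢p′) (extend-after-p σ p)
                (cong (λ v → lookup v (inject₁ p)) (sym eq))))
  ... | yes refl = refl , lookup-ext agree
    where
    agree : ∀ i → lookup σ i ≡ lookup σ′ i
    agree i with i Finₚ.≟ p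
    ... | yes refl = Finₚ.inject₁-injective
      (subst₂ _≡_ (extend-after-last σ i) (extend-after-last σ′ i) (cong (λ v → lookup v (fromℕ m)) eq))
    ... | no i≢p = Finₚ.inject₁-injective
      (subst₂ _≡_ (extend-after-inject₁ σ p i i≢p) (extend-after-inject₁ σ′ p i i≢p)
                  (cong (λ v → lookup v (inject₁ i)) eq))

  lower : ∀ {m} (x : Fin (suc m)) → x ≢ fromℕ m → Fin m
  lower {m} x x≢m = Fin.lower₁ x λ m≡x →
    x≢m (Finₚ.toℕ-injective (trans (sym m≡x) (sym (Finₚ.toℕ-fromℕ m))))

  inject₁-lower : ∀ {m} (x : Fin (suc m)) (x≢m : x ≢ fromℕ m) → inject₁ (lower x x≢m) ≡ x
  inject₁-lower x x≢m = Finₚ.inject₁-lower₁ x _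

  module _ {m} (v : Vec (Fin (suc m)) (suc m)) (v-perm : IsPermutation v) where

    extend-fixed⁻¹ : lookup v (fromℕ m) ≡ fromℕ m → ∃ λ σ → v ≡ extend nothing σ
    extend-fixed⁻¹ v-last = σ , lookup-ext agree
      where
      v-inject₁ : ∀ i → lookup v (inject₁ i) ≢ fromℕ m
      v-inject₁ i eq = inject₁≢fromℕ (v-perm (trans eq (sym v-last)))
      σ : Vec (Fin m) m
      σ = Vec.tabulate λ i → lower (lookup v (inject₁ i)) (v-inject₁ i)
      agree : ∀ a → lookup v a ≡ lookup (extend nothing σ) a
      agree a with initOrLast a
      ... | last′   = trans v-last (sym (extend-fixed-last σ))
      ... | init′ i = sym (trans (extend-fixed-inject₁ σ i)
                        (trans (cong inject₁ (Vecₚ.lookup∘tabulate _ i)) (inject₁-lower _ (v-inject₁ i))))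

    extend-after⁻¹ : ∀ p → lookup v (inject₁ p) ≡ fromℕ m → ∃ λ σ → v ≡ extend (just p) σ
    extend-after⁻¹ p v-p = σ , lookup-ext agree
      where
      u : Vec (Fin (suc m)) m
      u = Vec.tabulate (lookup v ∘ inject₁) [ p ]≔ lookup v (fromℕ m)
      u-p : lookup u p ≡ lookup v (fromℕ m)
      u-p = Vecₚ.lookup∘update p (Vec.tabulate (lookup v ∘ inject₁)) (lookup v (fromℕ m))
      u-other : ∀ i → i ≢ p → lookup u i ≡ lookup v (inject₁ i)
      u-other i i≢p = trans (Vecₚ.lookup∘update′ i≢p (Vec.tabulate (lookup v ∘ inject₁)) (lookup v (fromℕ m)))
                            (Vecₚ.lookup∘tabulate (lookup v ∘ inject₁) i)
      u≢m : ∀ i → lookup u i ≢ fromℕ m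
      u≢m i eq with i Finₚ.≟ p
      ... | yes refl = inject₁≢fromℕ (sym (v-perm (trans (sym u-p) (trans eq (sym v-p)))))
      ... | no i≢p   = i≢p (Finₚ.inject₁-injective (v-perm (trans (sym (u-other i i≢p)) (trans eq (sym v-p)))))
      σ : Vec (Fin m) m
      σ = Vec.tabulate λ i → lower (lookup u i) (u≢m i)
      σ-u : ∀ i → inject₁ (lookup σ i) ≡ lookup u i
      σ-u i = trans (cong inject₁ (Vecₚ.lookup∘tabulate _ i)) (inject₁-lower _ (u≢m i))
      agree : ∀ a → lookup v a ≡ lookup (extend (just p) σ) a
      agree a with initOrLast a
      ... | last′ = sym (trans (extend-after-last σ p) (trans (σ-u p) u-p))
      ... | init′ i with i Finₚ.≟ p
      ...   | yes refl = trans v-p (sym (extend-after-p σ i))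
      ...   | no i≢p   = sym (trans (extend-after-inject₁ σ p i i≢p) (trans (σ-u i) (u-other i i≢p)))

    extend-surjective : ∃₂ λ j σ → v ≡ extend j σ
    extend-surjective with a , va≡m ← count>0⇒∃ (λ a → lookup v a == fromℕ m)
                                        (subst (0 <_) (sym (count-fibre v-perm (fromℕ m))) (s≤s z≤n))
                      with initOrLast a
    ... | last′   = nothing , extend-fixed⁻¹ (==⇒≡ va≡m)
    ... | init′ p = just p , extend-after⁻¹ p (==⇒≡ va≡m)

  isInjective-entry : ∀ {m} (v : Vec (Fin m) m) → T (isInjective v) →
                      ∀ i j → T (not (lookup v i == lookup v j) ∨ (i == j))
  isInjective-entry {m} v inj i j = tabulate⁻ (all⁺ _ (allFin m) (tabulate⁻ (all⁺ _ (allFin m) inj) i)) j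

  isInjective⇒isPermutation : ∀ {m} (v : Vec (Fin m) m) → T (isInjective v) → IsPermutation v
  isInjective⇒isPermutation v inj {i} {j} vi≡vj with Equivalence.to T-∨ (isInjective-entry v inj i j)
  ... | inj₂ i==j  = ==⇒≡ i==j
  ... | inj₁ vi≠vj = ⊥-elim (subst (T ∘ not) (trans (cong (_== lookup v j) vi≡vj) (==-refl (lookup v j))) vi≠vj)

  isPermutation⇒isInjective : ∀ {m} (v : Vec (Fin m) m) → IsPermutation v → T (isInjective v)
  isPermutation⇒isInjective {m} v v-perm = all⁻ _ (tabulate⁺ λ i → all⁻ _ (tabulate⁺ λ j → pair i j))
    where
    pair : ∀ i j → T (not (lookup v i == lookup v j) ∨ (i == j))
    pair i j with i Finₚ.≟ j
    ... | yes refl = Equivalence.from (T-∨ {not (lookup v i == lookup v i)}) (inj₂ _)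
    ... | no  i≢j  rewrite ==-≢ (i≢j ∘ v-perm) = _

  newPoints : ∀ m → List (Maybe (Fin m))
  newPoints m = nothing ∷ List.map just (allFin m)

  permutations : ∀ m → List (Vec (Fin m) m)
  permutations zero    = [] ∷ []
  permutations (suc m) = List.cartesianProductWith extend (newPoints m) (permutations m)

  ∈-newPoints : ∀ {m} (j : Maybe (Fin m)) → j ∈ newPoints m
  ∈-newPoints nothing  = here refl
  ∈-newPoints (just p) = there (∈-map⁺ just (∈-allFin p))

  ∈-permutations⁻ : ∀ {m} {v : Vec (Fin m) m} → v ∈ permutations m → IsPermutation v
  ∈-permutations⁻ {zero} (here refl) {()}
  ∈-permutations⁻ {suc m} v∈
    with j , σ , _ , σ∈ , refl ← ∈-cartesianProductWith⁻ extend (newPoints m) (permutations m) v∈ =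
      extend-isPermutation j σ (∈-permutations⁻ σ∈)

  ∈-permutations⁺ : ∀ {m} {v : Vec (Fin m) m} → IsPermutation v → v ∈ permutations m
  ∈-permutations⁺ {zero} {[]} _ = here refl
  ∈-permutations⁺ {suc m} {v} v-perm with j , σ , refl ← extend-surjective v v-perm =
    ∈-cartesianProductWith⁺ extend (∈-newPoints j) (∈-permutations⁺ (extend-isPermutation⁻ j σ v-perm))

  newPoints-unique : ∀ m → Unique (newPoints m)
  newPoints-unique m =
    Allₚ.map⁺ (All.universal nothing≢just (allFin m)) ∷ Uniqueₚ.map⁺ Maybeₚ.just-injective (Uniqueₚ.allFin⁺ m)
    where
    nothing≢just : ∀ p → nothing ≢ just p
    nothing≢just p ()

  permutations-unique : ∀ m → Unique (permutations m)
  permutations-unique zero    = All.[] ∷ []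
  permutations-unique (suc m) =
    Uniqueₚ.cartesianProductWith⁺ extend extend-injective (newPoints-unique m) (permutations-unique m)

  concatMap-cartesianProductWith : ∀ {a b c} {A : Set a} {B : Set b} {C : Set c} (f : A → B → C) xs ys →
    concatMap (λ x → List.map (f x) ys) xs ≡ List.cartesianProductWith f xs ys
  concatMap-cartesianProductWith f []  ys = refl
  concatMap-cartesianProductWith f (x ∷ xs) ys = cong (List.map (f x) ys List.++_) (concatMap-cartesianProductWith f xs ys)

  allVecs-unique : ∀ k n → Unique (allVecs k n)
  allVecs-unique k zero    = All.[] ∷ []
  allVecs-unique k (suc n) = subst Unique (sym (concatMap-cartesianProductWith _∷_ (allFin k) (allVecs k n)))
    (Uniqueₚ.cartesianProductWith⁺ _∷_ Vecₚ.∷-injective (Uniqueₚ.allFin⁺ k) (allVecs-unique k n))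

  ∈-allVecs : ∀ {k n} (v : Vec (Fin k) n) → v ∈ allVecs k n
  ∈-allVecs []       = here refl
  ∈-allVecs {k} {suc n} (x ∷ xs) =
    subst (x ∷ xs ∈_) (sym (concatMap-cartesianProductWith _∷_ (allFin k) (allVecs k n)))
      (∈-cartesianProductWith⁺ _∷_ (∈-allFin x) (∈-allVecs xs))

  ∈-Perms⁻ : ∀ {m} {v : Vec (Fin m) m} → v ∈ Perms m → IsPermutation v
  ∈-Perms⁻ {m} {v} v∈ =
    isInjective⇒isPermutation v (proj₂ (∈-filter⁻ (T? ∘ isInjective) {xs = allVecs m m} v∈))

  ∈-Perms⁺ : ∀ {m} {v : Vec (Fin m) m} → IsPermutation v → v ∈ Perms m
  ∈-Perms⁺ {m} {v} v-perm = ∈-filter⁺ (T? ∘ isInjective) (∈-allVecs v) (isPermutation⇒isInjective v v-perm)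

  Perms↭permutations : ∀ m → Perms m ↭ permutations m
  Perms↭permutations m = ∼bag⇒↭ (unique∧set⇒bag
    (Uniqueₚ.filter⁺ (T? ∘ isInjective) (allVecs-unique m m)) (permutations-unique m)
    (mk⇔ (∈-permutations⁺ ∘ ∈-Perms⁻) (∈-Perms⁺ ∘ ∈-permutations⁻)))

  module _ {m} (σ : Vec (Fin m) m) where

    inversions-extend-fixed : inversions (extend nothing σ) ≡ inversions σ
    inversions-extend-fixed = begin
      inversions (extend nothing σ)                       ≡⟨ inversions≡inversionCount (extend nothing σ) ⟩
      inversionCount w                                    ≡⟨ inversionCount-snoc-max w below-last ⟩
      inversionCount (init w)                             ≡⟨ inversionCount-cong init-w ⟩
      inversionCount (toℕ ∘ lookup σ)                     ≡⟨ inversions≡inversionCount σ ⟨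
      inversions σ                                        ∎
      where
      open ≡-Reasoning
      w : Fin (suc m) → ℕ
      w = toℕ ∘ lookup (extend nothing σ)
      init-w : ∀ i → init w i ≡ toℕ (lookup σ i)
      init-w i = trans (cong toℕ (extend-fixed-inject₁ σ i)) (Finₚ.toℕ-inject₁ _)
      below-last : ∀ i → init w i ≤ last w
      below-last i = subst₂ _≤_ (sym (cong toℕ (extend-fixed-inject₁ σ i))) (sym (cong toℕ (extend-fixed-last σ)))
                            (Finₚ.≤fromℕ (inject₁ (lookup σ i)))

    isEven-inversions-extend-after : IsPermutation σ → ∀ p →
                                     isEven (inversions (extend (just p) σ)) ≡ not (isEven (inversions σ))
    isEven-inversions-extend-after σ-perm p
      rewrite inversions≡inversionCount (extend (just p) σ) | inversions≡inversionCount σ =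
      InsertionInversions.parity-flips σ-perm p (toℕ ∘ lookup (extend (just p) σ))
        (trans (cong toℕ (extend-after-p σ p)) (Finₚ.toℕ-fromℕ m))
        (λ i i≢p → trans (cong toℕ (extend-after-inject₁ σ p i i≢p)) (Finₚ.toℕ-inject₁ _))
        (trans (cong toℕ (extend-after-last σ p)) (Finₚ.toℕ-inject₁ _))

    cycleCount-extend-fixed : cycleCount (extend nothing σ) ≡ suc (cycleCount σ)
    cycleCount-extend-fixed =
      FixedPointExtension.cycleCount-extend σ (extend nothing σ) (extend-fixed-inject₁ σ) (extend-fixed-last σ)

    cycleCount-extend-after : ∀ p → cycleCount (extend (just p) σ) ≡ cycleCount σ
    cycleCount-extend-after p =
      CycleInsertion.cycleCount-insert σ (extend (just p) σ) p
        (extend-after-inject₁ σ p) (extend-after-p σ p) (extend-after-last σ p)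

open Combinatorics

-- The signed cycle sum

module _ {c ℓ} (R : CommutativeRing c ℓ) where
  open CommutativeRing R
  open RingProperties ring using (x∙y⁻¹≈ε⇒x≈y)

  fallingFactorial : Carrier → ℕ → Carrier
  fallingFactorial x zero    = 1#
  fallingFactorial x (suc m) = fallingFactorial x m * (x - natCast R m)

  fallingFactorial-root : IsIntegralDomain R → ∀ x n → fallingFactorial x (suc n) ≈ 0# →
                          ∃ λ k → k ≤ n × x ≈ natCast R k
  fallingFactorial-root domain x n product≈0 with IsIntegralDomain.noZeroDivisors domain _ _ product≈0
  ... | inj₂ x-n≈0 = n , ℕ.≤-refl , x∙y⁻¹≈ε⇒x≈y x (natCast R n) x-n≈0
  ... | inj₁ rest≈0 with n
  ...   | zero  = ⊥-elim (IsIntegralDomain.1≉0 domain rest≈0)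
  ...   | suc n′ with k , k≤n′ , x≈k ← fallingFactorial-root domain x n′ rest≈0 =
    k , ℕ.m≤n⇒m≤1+n k≤n′ , x≈k

module SignedCycleSum {c₁ ℓ₁ c₂ ℓ₂} (A : CommutativeRing c₁ ℓ₁) (B : CommutativeRing c₂ ℓ₂) where
  open CommutativeRing B
  open RingProperties ring using (-‿distribˡ-*; -‿distribʳ-*; -‿involutive; -0#≈0#; -‿+-comm)
  open CommSemigroupProperties *-commutativeSemigroup using (x∙yz≈y∙xz)
  open RawSemiringDefinitions (Semiring.rawSemiring semiring) using (_^_)
  open ≈-Reasoning setoid

  sumOver : ∀ {X : Set} → List X → (X → Carrier) → Carrier
  sumOver xs t = List.foldr (λ x acc → t x + acc) 0# xs

  sumOver-cong : ∀ {X : Set} (xs : List X) {t u : X → Carrier} →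
                 (∀ {x} → x ∈ xs → t x ≈ u x) → sumOver xs t ≈ sumOver xs u
  sumOver-cong []       t≈u = refl
  sumOver-cong (x ∷ xs) t≈u = +-cong (t≈u (here P.refl)) (sumOver-cong xs (t≈u ∘ there))

  sumOver-↭ : ∀ {X : Set} {xs ys : List X} (t : X → Carrier) → xs ↭ ys → sumOver xs t ≈ sumOver ys t
  sumOver-↭ {xs = xs} {ys} t xs↭ys = begin
    sumOver xs t                        ≡⟨ Listₚ.foldr-map _+_ t 0# xs ⟨
    List.foldr _+_ 0# (List.map t xs)   ≈⟨ PermutationSetoidProperties.foldr-commMonoid setoid +-isCommutativeMonoid
                                             (↭⇒↭ₛ′ isEquivalence (↭-map⁺ t xs↭ys)) ⟩
    List.foldr _+_ 0# (List.map t ys)   ≡⟨ Listₚ.foldr-map _+_ t 0# ys ⟩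
    sumOver ys t                        ∎

  sumOver-++ : ∀ {X : Set} (xs ys : List X) (t : X → Carrier) →
               sumOver (xs List.++ ys) t ≈ sumOver xs t + sumOver ys t
  sumOver-++ []       ys t = sym (+-identityˡ _)
  sumOver-++ (x ∷ xs) ys t = trans (+-congˡ (sumOver-++ xs ys t)) (sym (+-assoc _ _ _))

  sumOver-*ˡ : ∀ {X : Set} (xs : List X) c (t : X → Carrier) → sumOver xs (λ x → c * t x) ≈ c * sumOver xs t
  sumOver-*ˡ []       c t = sym (zeroʳ c)
  sumOver-*ˡ (x ∷ xs) c t = trans (+-congˡ (sumOver-*ˡ xs c t)) (sym (distribˡ c _ _))

  sumOver-neg : ∀ {X : Set} (xs : List X) (t : X → Carrier) → sumOver xs (λ x → - t x) ≈ - sumOver xs t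
  sumOver-neg []       t = sym -0#≈0#
  sumOver-neg (x ∷ xs) t = trans (+-congˡ (sumOver-neg xs t)) (-‿+-comm _ _)

  sign-extend-fixed : ∀ {m} (σ : Vec (Fin m) m) → sign A B (extend nothing σ) ≡ sign A B σ
  sign-extend-fixed σ = P.cong (λ n → if isEven n then 1# else - 1#) (inversions-extend-fixed σ)

  sign-extend-after : ∀ {m} (σ : Vec (Fin m) m) → IsPermutation σ → ∀ p →
                      sign A B (extend (just p) σ) ≈ - sign A B σ
  sign-extend-after σ σ-perm p with isEven (inversions σ) | isEven-inversions-extend-after σ σ-perm p
  ... | true  | flipped rewrite flipped = refl
  ... | false | flipped rewrite flipped = sym (-‿involutive 1#)

  module _ (x : Carrier) where

    signedPower : ∀ {m} → Vec (Fin m) m → Carrier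
    signedPower σ = sign A B σ * x ^ cycleCount σ

    signedPower-extend-fixed : ∀ {m} (σ : Vec (Fin m) m) → signedPower (extend nothing σ) ≈ x * signedPower σ
    signedPower-extend-fixed σ rewrite sign-extend-fixed σ | cycleCount-extend-fixed σ =
      x∙yz≈y∙xz (sign A B σ) x (x ^ cycleCount σ)

    signedPower-extend-after : ∀ {m} (σ : Vec (Fin m) m) → IsPermutation σ → ∀ p →
      signedPower (extend (just p) σ) ≈ - signedPower σ
    signedPower-extend-after σ σ-perm p rewrite cycleCount-extend-after σ p =
      trans (*-congʳ (sign-extend-after σ σ-perm p)) (sym (-‿distribˡ-* _ _))

    signedSum : ℕ → Carrier
    signedSum m = sumOver (permutations m) signedPower

    signedSum-extend-after : ∀ m (ps : List (Fin m)) →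
      sumOver (List.cartesianProductWith extend (List.map just ps) (permutations m)) signedPower
        ≈ natCast B (length ps) * - signedSum m
    signedSum-extend-after m []       = sym (zeroˡ _)
    signedSum-extend-after m (p ∷ ps) = begin
      sumOver (List.map (extend (just p)) (permutations m) List.++ rest) signedPower
        ≈⟨ sumOver-++ (List.map (extend (just p)) (permutations m)) rest signedPower ⟩
      sumOver (List.map (extend (just p)) (permutations m)) signedPower + sumOver rest signedPower
        ≈⟨ +-cong (reflexive (Listₚ.foldr-map _ (extend (just p)) 0# (permutations m)))
                  (signedSum-extend-after m ps) ⟩
      sumOver (permutations m) (signedPower ∘ extend (just p)) + natCast B (length ps) * - signedSum m
        ≈⟨ +-congʳ (trans (sumOver-cong (permutations m) λ σ∈ →
                             signedPower-extend-after _ (∈-permutations⁻ σ∈) p)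
                          (sumOver-neg (permutations m) signedPower)) ⟩
      - signedSum m + natCast B (length ps) * - signedSum m
        ≈⟨ +-congʳ (*-identityˡ _) ⟨
      1# * - signedSum m + natCast B (length ps) * - signedSum m
        ≈⟨ distribʳ _ _ _ ⟨
      natCast B (suc (length ps)) * - signedSum m ∎
      where
      rest : List (Vec (Fin (suc m)) (suc m))
      rest = List.cartesianProductWith extend (List.map just ps) (permutations m)

    signedSum≈fallingFactorial : ∀ m → signedSum m ≈ fallingFactorial B x m
    signedSum≈fallingFactorial zero    = trans (+-identityʳ _) (*-identityˡ _)
    signedSum≈fallingFactorial (suc m) = begin
      sumOver (List.map (extend nothing) (permutations m) List.++ moved) signedPower
        ≈⟨ sumOver-++ (List.map (extend nothing) (permutations m)) moved signedPower ⟩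
      sumOver (List.map (extend nothing) (permutations m)) signedPower + sumOver moved signedPower
        ≈⟨ +-cong (reflexive (Listₚ.foldr-map _ (extend nothing) 0# (permutations m)))
                  (signedSum-extend-after m (allFin m)) ⟩
      sumOver (permutations m) (signedPower ∘ extend nothing) + natCast B (length (allFin m)) * - signedSum m
        ≈⟨ +-cong (trans (sumOver-cong (permutations m) λ {σ} _ → signedPower-extend-fixed σ)
                         (sumOver-*ˡ (permutations m) x signedPower))
                  (*-congʳ (reflexive (P.cong (natCast B) (Listₚ.length-tabulate {n = m} id)))) ⟩
      x * signedSum m + natCast B m * - signedSum m
        ≈⟨ +-congˡ (-‿distribʳ-* _ _) ⟨
      x * signedSum m + - (natCast B m * signedSum m)
        ≈⟨ +-congˡ (-‿distribˡ-* _ _) ⟩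
      x * signedSum m + - natCast B m * signedSum m
        ≈⟨ distribʳ _ _ _ ⟨
      (x - natCast B m) * signedSum m
        ≈⟨ *-comm _ _ ⟩
      signedSum m * (x - natCast B m)
        ≈⟨ *-congʳ (signedSum≈fallingFactorial m) ⟩
      fallingFactorial B x m * (x - natCast B m) ∎
      where
      moved : List (Vec (Fin (suc m)) (suc m))
      moved = List.cartesianProductWith extend (List.map just (allFin m)) (permutations m)

  module _ (f : CommutativeRing.Carrier A → Carrier)
           (f-cong : ∀ {u v} → CommutativeRing._≈_ A u v → f u ≈ f v)
           (a : CommutativeRing.Carrier A) (a-idempotent : CommutativeRing._≈_ A (CommutativeRing._*_ A a a) a)
    where
    private module A = CommutativeRing A

    product-idempotent : ∀ {X : Set} {y : X} {ys} → y ∈ ys → List.foldr (λ _ acc → a A.* acc) A.1# ys A.≈ a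
    product-idempotent {ys = _ ∷ []}     _ = A.*-identityʳ a
    product-idempotent {ys = _ ∷ z ∷ zs} _ =
      A.trans (A.*-congˡ (product-idempotent {ys = z ∷ zs} (here P.refl))) a-idempotent

    inCycle-refl : ∀ {m} (σ : Vec (Fin m) m) i → T (inCycle σ i i)
    inCycle-refl {suc m} σ i = Equivalence.from (T-∨ {i == i}) (inj₁ (P.subst T (P.sym (==-refl i)) _))

    fCycle-idempotent : ∀ {m} (σ : Vec (Fin m) m) i → fCycle A B f σ (λ _ → a) i ≈ f a
    fCycle-idempotent {m} σ i =
      f-cong (product-idempotent (∈-filter⁺ (T? ∘ inCycle σ i) (∈-allFin i) (inCycle-refl σ i)))

    product-const : ∀ {X : Set} (h : X → Carrier) → (∀ x → h x ≈ f a) → ∀ xs →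
      List.foldr (λ x acc → h x * acc) 1# xs ≈ f a ^ length xs
    product-const h h≈ []       = refl
    product-const h h≈ (x ∷ xs) = *-cong (h≈ x) (product-const h h≈ xs)

    fPerm-idempotent : ∀ {m} (σ : Vec (Fin m) m) → fPerm A B f σ (λ _ → a) ≈ f a ^ cycleCount σ
    fPerm-idempotent {m} σ = trans (product-const _ (fCycle-idempotent σ) (filterᵇ (isCycleRep σ) (allFin m)))
                                   (reflexive (P.cong (f a ^_) (length-filterᵇ-tabulate (isCycleRep σ) id)))

    Φ-idempotent : ∀ m → Φ A B m f (λ _ → a) ≈ fallingFactorial B (f a) m
    Φ-idempotent m = begin
      Φ A B m f (λ _ → a)                     ≈⟨ sumOver-cong (Perms m) (λ {σ} _ → *-congˡ (fPerm-idempotent σ)) ⟩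
      sumOver (Perms m) (signedPower (f a))   ≈⟨ sumOver-↭ (signedPower (f a)) (Perms↭permutations m) ⟩
      signedSum (f a) m                       ≈⟨ signedSum≈fallingFactorial (f a) m ⟩
      fallingFactorial B (f a) m              ∎

lemma2p14 : ∀ {k kℓ c₁ ℓ₁ c₂ ℓ₂ : Level}
    (K : CommutativeRing k kℓ) → IsField K → CharZero K →
    (A : CAlgebra K c₁ ℓ₁) (B : CAlgebra K c₂ ℓ₂) →
    IsIntegralDomain (CAlgebra.commRing B) →
    (f : CAlgebra.Carrier A → CAlgebra.Carrier B) → IsLinear A B f →
    (n : ℕ) (a : CAlgebra.Carrier A) →
    CAlgebra._≈_ A (CAlgebra._*_ A a a) a →
    CAlgebra._≈_ B (Φ (CAlgebra.commRing A) (CAlgebra.commRing B) (suc n) f (λ _ → a)) (CAlgebra.0# B) →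
    ∃ λ (m : ℕ) → m ≤ n × CAlgebra._≈_ B (f a) (natCast (CAlgebra.commRing B) m)
lemma2p14 K _ _ A B domain f f-linear n a a-idempotent Φ≈0 =
  fallingFactorial-root (commRing B) domain (f a) n (B.trans (B.sym Φ≈fallingFactorial) Φ≈0)
  where
  open CAlgebra using (commRing)
  module B = CAlgebra B
  Φ≈fallingFactorial : Φ (commRing A) (commRing B) (suc n) f (λ _ → a) B.≈ fallingFactorial (commRing B) (f a) (suc n)
  Φ≈fallingFactorial =
    SignedCycleSum.Φ-idempotent (commRing A) (commRing B) f (IsLinear.cong f-linear) a a-idempotent (suc n)
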